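{- If $n\geq 3$ is an integer, then $\#\mathcal V_n^+(\mathbb Z)\geq f_n$.
   Context: $f_n$ denotes the Fibonacci sequence: $f_0=0$, $f_1=1$, $f_n=f_{n-1}+f_{n-2}$ for $n\geq 2$. $A_n$ is the $2\times n$ matrix with first row $(f_1,\ldots,f_n)$ and second row $(f_0,\ldots,f_{n-1})$; $\mathcal V_n^+(\mathbb Z)$ is the set of ${\bf x}\in\mathbb Z^n$ with all entries non-negative and $A_n{\bf x}=(f_n,f_{n-1})^T$. -}

module Defs where

open import Data.Nat using (ℕ; zero; suc; _+_; _*_; _∸_)
open import Data.Fin using (Fin; toℕ)
open import Data.Vec using (Vec; []; _∷_; tabulate; zipWith; foldr; map)
open import Relation.Binary.PropositionalEquality using (_≡_)

fib : ℕ → ℕ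
fib zero = 0
fib (suc zero) = 1
fib (suc (suc n)) = fib (suc n) + fib n

dot : ∀ {n} → Vec ℕ n → Vec ℕ n → ℕ
dot u v = foldr _ _+_ 0 (zipWith _*_ u v)

-- The 2×n matrix A_n: first row (f_1,…,f_n), second row (f_0,…,f_{n-1}).
-- Column with index i : Fin n is column i+1 of the paper.
A : (n : ℕ) → Vec (Vec ℕ n) 2
A n = tabulate (λ i → fib (suc (toℕ i))) ∷ tabulate (λ i → fib (toℕ i)) ∷ []

_·_ : ∀ {m n} → Vec (Vec ℕ n) m → Vec ℕ n → Vec ℕ m
M · x = map (λ row → dot row x) M

-- x ∈ 𝒱ₙ⁺(ℤ): x a non-negative integer vector (so a vector of naturals) with
-- A_n x = (f_n, f_{n-1})ᵀ
InV+ : (n : ℕ) → Vec ℕ n → Set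
InV+ n x = A n · x ≡ (fib n ∷ fib (n ∸ 1) ∷ [])

{-# OPTIONS --safe #-}
module Submission where

-- Every solution y ∈ 𝒱ₙ₋₁⁺ gives the solution (0, y) ∈ 𝒱ₙ⁺, and every solution
-- z ∈ 𝒱ₙ₋₂⁺ gives (f_{n-3}, f_{n-2}, 0, …, 0) + (z, 0, 0) ∈ 𝒱ₙ⁺, because
-- f_{n-3} + 2 f_{n-2} = f_n and f_{n-2} + f_{n-3} = f_{n-1}.  The first entry
-- separates the two kinds (0 against a positive number), and both maps are
-- injective, so #𝒱ₙ⁺ ≥ #𝒱ₙ₋₁⁺ + #𝒱ₙ₋₂⁺; starting from 𝒱₁⁺ = {(1)} this
-- yields an explicit injective family of fₙ solutions.

open import Defs
open import Algebra.Properties.CommutativeSemigroup using (interchange)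
open import Data.Fin using (Fin; zero; toℕ; splitAt; join)
open import Data.Fin.Properties using (join-splitAt)
open import Data.Nat using (ℕ; zero; suc; _+_; _*_; _<_; _≤_; z<s)
open import Data.Nat.Properties
  using (+-comm; +-identityʳ; *-identityˡ; *-zeroʳ; *-distribˡ-+; *-distribʳ-+;
         +-cancelˡ-≡; +-commutativeSemigroup; m≤m+n; <-≤-trans; <⇒≢)
open import Data.Product using (Σ; _×_; _,_)
open import Data.Sum using (inj₁; inj₂; [_,_])
open import Data.Vec using (Vec; []; _∷_; _∷ʳ_; head; replicate; tabulate; zipWith)
open import Data.Vec.Properties using (∷-injective; ∷-injectiveʳ; ∷ʳ-injectiveˡ)
open import Data.Vec.Functional using (Vector; map; _++_)
open import Data.Vec.Functional.Relation.Unary.All using (All)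
open import Data.Vec.Functional.Relation.Unary.All.Properties using (++⁺)
open import Function using (_∘_)
open import Level using (Level)
open import Function.Definitions using (Injective)
open import Function.Construct.Composition using (injective)
open import Relation.Binary.PropositionalEquality using (_≡_; _≢_; refl; sym; trans; cong; cong₂; module ≡-Reasoning)
open import Relation.Nullary using (contradiction)
open ≡-Reasoning

private
  variable
    a : Level
    X : Set a
    k m t : ℕ

++-injective : {xs : Vector X m} {ys : Vector X k} →
               Injective _≡_ _≡_ xs → Injective _≡_ _≡_ ys → (∀ i j → xs i ≢ ys j) →
               Injective _≡_ _≡_ (xs ++ ys)
++-injective {m = m} {k = k} {xs = xs} {ys} xs-inj ys-inj disjoint {i} {j} eq =
  begin
    i                        ≡⟨ join-splitAt m k i ⟨
    join m k (splitAt m i)   ≡⟨ cong (join m k) (split-injective (splitAt m i) (splitAt m j) eq) ⟩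
    join m k (splitAt m j)   ≡⟨ join-splitAt m k j ⟩
    j                        ∎
  where
  split-injective : ∀ u v → [ xs , ys ] u ≡ [ xs , ys ] v → u ≡ v
  split-injective (inj₁ i) (inj₁ j) eq = cong inj₁ (xs-inj eq)
  split-injective (inj₁ i) (inj₂ j) eq = contradiction eq (disjoint i j)
  split-injective (inj₂ i) (inj₁ j) eq = contradiction (sym eq) (disjoint j i)
  split-injective (inj₂ i) (inj₂ j) eq = cong inj₂ (ys-inj eq)

zipWith-+-cancelˡ : (u v w : Vec ℕ k) → zipWith _+_ u v ≡ zipWith _+_ u w → v ≡ w
zipWith-+-cancelˡ [] [] [] _ = refl
zipWith-+-cancelˡ (x ∷ u) (y ∷ v) (z ∷ w) eq with ∷-injective eq
... | head-eq , tail-eq = cong₂ _∷_ (+-cancelˡ-≡ x y z head-eq) (zipWith-+-cancelˡ u v w tail-eq)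

row : (ℕ → ℕ) → Vec ℕ k → ℕ
row h [] = 0
row h (x ∷ xs) = h 0 * x + row (h ∘ suc) xs

dot-tabulate : (h : ℕ → ℕ) (x : Vec ℕ k) → dot (tabulate (h ∘ toℕ)) x ≡ row h x
dot-tabulate h [] = refl
dot-tabulate h (x ∷ xs) = cong (h 0 * x +_) (dot-tabulate (h ∘ suc) xs)

row-weights-+ : (p q : ℕ → ℕ) (x : Vec ℕ k) → row (λ i → p i + q i) x ≡ row p x + row q x
row-weights-+ p q [] = refl
row-weights-+ p q (x ∷ xs) = begin
  (p 0 + q 0) * x + row (λ i → p (suc i) + q (suc i)) xs
    ≡⟨ cong₂ _+_ (*-distribʳ-+ x (p 0) (q 0)) (row-weights-+ (p ∘ suc) (q ∘ suc) xs) ⟩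
  (p 0 * x + q 0 * x) + (row (p ∘ suc) xs + row (q ∘ suc) xs)
    ≡⟨ interchange +-commutativeSemigroup (p 0 * x) (q 0 * x) _ _ ⟩
  (p 0 * x + row (p ∘ suc) xs) + (q 0 * x + row (q ∘ suc) xs) ∎

row-zipWith-+ : (h : ℕ → ℕ) (u v : Vec ℕ k) → row h (zipWith _+_ u v) ≡ row h u + row h v
row-zipWith-+ h [] [] = refl
row-zipWith-+ h (x ∷ u) (y ∷ v) = begin
  h 0 * (x + y) + row (h ∘ suc) (zipWith _+_ u v)
    ≡⟨ cong₂ _+_ (*-distribˡ-+ (h 0) x y) (row-zipWith-+ (h ∘ suc) u v) ⟩
  (h 0 * x + h 0 * y) + (row (h ∘ suc) u + row (h ∘ suc) v)
    ≡⟨ interchange +-commutativeSemigroup (h 0 * x) (h 0 * y) _ _ ⟩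
  (h 0 * x + row (h ∘ suc) u) + (h 0 * y + row (h ∘ suc) v) ∎

row-0∷ : (h : ℕ → ℕ) (xs : Vec ℕ k) → row h (0 ∷ xs) ≡ row (h ∘ suc) xs
row-0∷ h xs = cong (_+ row (h ∘ suc) xs) (*-zeroʳ (h 0))

row-replicate-0 : (h : ℕ → ℕ) (k : ℕ) → row h (replicate k 0) ≡ 0
row-replicate-0 h zero = refl
row-replicate-0 h (suc k) = trans (row-0∷ h (replicate k 0)) (row-replicate-0 (h ∘ suc) k)

row-∷ʳ-0 : (h : ℕ → ℕ) (xs : Vec ℕ k) → row h (xs ∷ʳ 0) ≡ row h xs
row-∷ʳ-0 h [] = row-replicate-0 h 1
row-∷ʳ-0 h (x ∷ xs) = cong (h 0 * x +_) (row-∷ʳ-0 (h ∘ suc) xs)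

-- A x = (f_{m+1}, f_m) for x of any length; indexing by m = n - 1 avoids the
-- truncated subtraction n ∸ 1 of InV+.
record Solves (m : ℕ) (x : Vec ℕ k) : Set where
  constructor solves
  field
    first-row  : row (fib ∘ suc) x ≡ fib (suc m)
    second-row : row fib x ≡ fib m

solves⇒InV+ : {x : Vec ℕ (suc m)} → Solves m x → InV+ (suc m) x
solves⇒InV+ {x = x} (solves first-row second-row) =
  cong₂ (λ a b → a ∷ b ∷ [])
    (trans (dot-tabulate (fib ∘ suc) x) first-row)
    (trans (dot-tabulate fib x) second-row)

solves-0∷ : {y : Vec ℕ k} → Solves m y → Solves (suc m) (0 ∷ y)
solves-0∷ {y = y} (solves first-row second-row) =
  solves
    (trans (row-0∷ (fib ∘ suc) y) (trans (row-weights-+ (fib ∘ suc) fib y) (cong₂ _+_ first-row second-row)))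
    (trans (row-0∷ fib y) first-row)

lift : ℕ → Vec ℕ k → Vec ℕ (suc (suc k))
lift t z = zipWith _+_ (fib t ∷ fib (suc t) ∷ replicate _ 0) (z ∷ʳ 0 ∷ʳ 0)

row-lift : (h : ℕ → ℕ) (t : ℕ) (z : Vec ℕ k) →
           row h (lift t z) ≡ h 0 * fib t + h 1 * fib (suc t) + row h z
row-lift {k = k} h t z = begin
  row h (lift t z)
    ≡⟨ row-zipWith-+ h (fib t ∷ fib (suc t) ∷ replicate k 0) (z ∷ʳ 0 ∷ʳ 0) ⟩
  h 0 * fib t + (h 1 * fib (suc t) + row (h ∘ suc ∘ suc) (replicate k 0)) + row h (z ∷ʳ 0 ∷ʳ 0)
    ≡⟨ cong₂ (λ r s → h 0 * fib t + (h 1 * fib (suc t) + r) + s)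
         (row-replicate-0 (h ∘ suc ∘ suc) k)
         (trans (row-∷ʳ-0 h (z ∷ʳ 0)) (row-∷ʳ-0 h z)) ⟩
  h 0 * fib t + (h 1 * fib (suc t) + 0) + row h z
    ≡⟨ cong (λ r → h 0 * fib t + r + row h z) (+-identityʳ (h 1 * fib (suc t))) ⟩
  h 0 * fib t + h 1 * fib (suc t) + row h z ∎

solves-lift : {z : Vec ℕ k} → Solves t z → Solves (suc (suc t)) (lift t z)
solves-lift {t = t} {z = z} (solves first-row second-row) = solves
  (begin
    row (fib ∘ suc) (lift t z)                        ≡⟨ row-lift (fib ∘ suc) t z ⟩
    1 * fib t + 1 * fib (suc t) + row (fib ∘ suc) z
      ≡⟨ cong₂ _+_ (cong₂ _+_ (*-identityˡ (fib t)) (*-identityˡ (fib (suc t)))) first-row ⟩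
    fib t + fib (suc t) + fib (suc t)                 ≡⟨ cong (_+ fib (suc t)) (+-comm (fib t) (fib (suc t))) ⟩
    fib (suc (suc (suc t)))                           ∎)
  (begin
    row fib (lift t z)                                ≡⟨ row-lift fib t z ⟩
    0 * fib t + 1 * fib (suc t) + row fib z           ≡⟨ cong₂ _+_ (*-identityˡ (fib (suc t))) second-row ⟩
    fib (suc (suc t))                                 ∎)

lift-injective : (t : ℕ) → Injective _≡_ _≡_ (lift {k} t)
lift-injective t {z} {z′} eq =
  ∷ʳ-injectiveˡ z z′ (∷ʳ-injectiveˡ (z ∷ʳ 0) (z′ ∷ʳ 0) (zipWith-+-cancelˡ _ _ _ eq))

0∷≢lift : (y : Vec ℕ (suc k)) (z : Vec ℕ k) → 0 < head (lift t z) → 0 ∷ y ≢ lift t z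
0∷≢lift y z positive eq = <⇒≢ positive (cong head eq)

lift-head-≥ : (z : Vec ℕ (suc k)) → fib t ≤ head (lift t z)
lift-head-≥ (z₀ ∷ zs) = m≤m+n _ z₀

fib-suc-positive : (n : ℕ) → 0 < fib (suc n)
fib-suc-positive zero = z<s
fib-suc-positive (suc n) = <-≤-trans (fib-suc-positive n) (m≤m+n _ _)

solutions : (n : ℕ) → Vector (Vec ℕ n) (fib n)
solutions zero = λ ()
solutions (suc zero) = λ _ → 1 ∷ []
solutions (suc (suc zero)) = map (0 ∷_) (solutions 1)
solutions (suc (suc (suc t))) = map (0 ∷_) (solutions (suc (suc t))) ++ map (lift t) (solutions (suc t))

solutions-solve : (m : ℕ) → All (Solves m) (solutions (suc m))
solutions-solve zero _ = solves refl refl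
solutions-solve (suc zero) i = solves-0∷ (solutions-solve 0 i)
solutions-solve (suc (suc t)) =
  ++⁺ (Solves (suc (suc t)))
    (λ i → solves-0∷ (solutions-solve (suc t) i))
    (λ j → solves-lift (solutions-solve t j))

-- For t = 0 the offset fib 0 vanishes, but then z = (1).
lift-solutions-head-positive : (t : ℕ) (j : Fin (fib (suc t))) → 0 < head (lift t (solutions (suc t) j))
lift-solutions-head-positive zero j = z<s
lift-solutions-head-positive (suc t) j =
  <-≤-trans (fib-suc-positive t) (lift-head-≥ {t = suc t} (solutions (suc (suc t)) j))

solutions-injective : (n : ℕ) → Injective _≡_ _≡_ (solutions n)
solutions-injective zero {()}
solutions-injective (suc zero) {zero} {zero} _ = refl
solutions-injective (suc (suc zero)) = injective _≡_ _≡_ _≡_ {g = 0 ∷_} (solutions-injective 1) ∷-injectiveʳ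
solutions-injective (suc (suc (suc t))) =
  ++-injective
    (injective _≡_ _≡_ _≡_ {g = 0 ∷_} (solutions-injective (suc (suc t))) ∷-injectiveʳ)
    (injective _≡_ _≡_ _≡_ (solutions-injective (suc t)) (lift-injective t))
    (λ i j → 0∷≢lift {t = t} _ _ (lift-solutions-head-positive t j))

theorem4p1 : (n : ℕ) → 3 ≤ n →
    Σ (Fin (fib n) → Vec ℕ n) (λ g →
      ((k : Fin (fib n)) → InV+ n (g k)) ×
      ((k l : Fin (fib n)) → g k ≡ g l → k ≡ l))
theorem4p1 zero ()
theorem4p1 (suc m) _ =
  solutions (suc m) ,
  (λ k → solves⇒InV+ (solutions-solve m k)) ,
  (λ k l → solutions-injective (suc m))
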